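{- The theory $\mathcal T$ has the cut elimination property: every sequent provable in natural deduction modulo the congruence of $\mathcal T$ has a cut-free proof, i.e. a proof whose proof-term is in normal form for proof reduction.
   Context: $\mathcal T$ is the following theory in deduction modulo, with no axioms. Its language has one sort (of "types"), a constant $nat$, a binary function symbol $\rightarrow$ (written infix), and a unary predicate symbol $\varepsilon$. Its rewrite rules are $\varepsilon(nat)\longrightarrow\forall p~(\varepsilon(p)\Rightarrow(\varepsilon(nat)\Rightarrow\varepsilon(p)\Rightarrow\varepsilon(p))\Rightarrow\varepsilon(p))$ and $\varepsilon(y\rightarrow z)\longrightarrow\varepsilon(y)\Rightarrow\varepsilon(z)$. Let $\equiv$ be the congruence on propositions generated by these rules. Natural deduction modulo $\equiv$ is intuitionistic natural deduction in which every rule's requirement on the shape of a proposition only has to hold up to $\equiv$ (e.g. the axiom rule derives $B$ from a hypothesis $A$ with $A\equiv B$; $\Rightarrow$-elimination derives $B$ from $C$ and $A$ whenever $C\equiv A\Rightarrow B$; $\forall$-elimination derives $C$ from $B$ when $B\equiv\forall x~A$ and $C\equiv(t/x)A$; similarly for the other rules). Proofs are represented by proof-terms $\pi ::= \alpha \mid \lambda\alpha~\pi \mid (\pi~\pi') \mid \langle\pi,\pi'\rangle \mid fst(\pi)\mid snd(\pi)\mid i(\pi)\mid j(\pi)\mid \delta(\pi_1,\alpha\pi_2,\beta\pi_3)\mid I\mid \delta_\bot(\pi)\mid \lambda x~\pi\mid(\pi~t)\mid\langle t,\pi\rangle\mid\delta_\exists(\pi,x\alpha\pi')$, and proof reduction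 (cut elimination steps) is the contextual closure of $(\lambda\alpha~\pi_1~\pi_2)\triangleright(\pi_2/\alpha)\pi_1$, $(\lambda x~\pi~t)\triangleright(t/x)\pi$, $fst\langle\pi_1,\pi_2\rangle\triangleright\pi_1$, $snd\langle\pi_1,\pi_2\rangle\triangleright\pi_2$, $\delta(i(\pi_1),\alpha\pi_2,\beta\pi_3)\triangleright(\pi_1/\alpha)\pi_2$, $\delta(j(\pi_1),\alpha\pi_2,\beta\pi_3)\triangleright(\pi_1/\beta)\pi_3$, $\delta_\exists(\langle t,\pi_1\rangle,x\alpha\pi_2)\triangleright(t/x,\pi_1/\alpha)\pi_2$. -}

module Defs where

open import Data.Nat using (ℕ; zero; suc)
open import Data.List using (List; []; _∷_; map)
open import Data.Product using (Σ; _×_; _,_; ∃)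
open import Relation.Nullary using (¬_)
open import Relation.Binary.Construct.Closure.Equivalence using (EqClosure)

-- terms of sort "types": variables, the constant nat, and y → z
data Tm : Set where
  var : ℕ → Tm
  nat : Tm
  _⇛_ : Tm → Tm → Tm

infixr 30 _⇛_

data Fm : Set where
  ε    : Tm → Fm
  _⇒_  : Fm → Fm → Fm
  _∧_  : Fm → Fm → Fm
  _∨_  : Fm → Fm → Fm
  ⊤'   : Fm
  ⊥'   : Fm
  ∀'   : Fm → Fm          -- binds term variable 0
  ∃'   : Fm → Fm          -- binds term variable 0

infixr 10 _⇒_
infixr 12 _∨_
infixr 14 _∧_

ext : (ℕ → ℕ) → ℕ → ℕ
ext ρ zero    = zero
ext ρ (suc n) = suc (ρ n)

renT : (ℕ → ℕ) → Tm → Tm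
renT ρ (var n) = var (ρ n)
renT ρ nat     = nat
renT ρ (y ⇛ z) = renT ρ y ⇛ renT ρ z

exts : (ℕ → Tm) → ℕ → Tm
exts σ zero    = var zero
exts σ (suc n) = renT suc (σ n)

subT : (ℕ → Tm) → Tm → Tm
subT σ (var n) = σ n
subT σ nat     = nat
subT σ (y ⇛ z) = subT σ y ⇛ subT σ z

subF : (ℕ → Tm) → Fm → Fm
subF σ (ε t)   = ε (subT σ t)
subF σ (A ⇒ B) = subF σ A ⇒ subF σ B
subF σ (A ∧ B) = subF σ A ∧ subF σ B
subF σ (A ∨ B) = subF σ A ∨ subF σ B
subF σ ⊤'      = ⊤'
subF σ ⊥'      = ⊥'
subF σ (∀' A)  = ∀' (subF (exts σ) A)
subF σ (∃' A)  = ∃' (subF (exts σ) A)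

σ₀ : Tm → ℕ → Tm
σ₀ t zero    = t
σ₀ t (suc n) = var n

_[_] : Fm → Tm → Fm
A [ t ] = subF (σ₀ t) A

↑F : Fm → Fm
↑F = subF (λ n → var (suc n))

Nat-def : Fm
Nat-def = ∀' (ε (var 0) ⇒ (ε nat ⇒ ε (var 0) ⇒ ε (var 0)) ⇒ ε (var 0))

data _⟶_ : Fm → Fm → Set where
  r-nat : ε nat ⟶ Nat-def
  r-arr : ∀ y z → ε (y ⇛ z) ⟶ (ε y ⇒ ε z)
  ⇒ₗ : ∀ {A A' B} → A ⟶ A' → (A ⇒ B) ⟶ (A' ⇒ B)
  ⇒ᵣ : ∀ {A B B'} → B ⟶ B' → (A ⇒ B) ⟶ (A ⇒ B')
  ∧ₗ : ∀ {A A' B} → A ⟶ A' → (A ∧ B) ⟶ (A' ∧ B)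
  ∧ᵣ : ∀ {A B B'} → B ⟶ B' → (A ∧ B) ⟶ (A ∧ B')
  ∨ₗ : ∀ {A A' B} → A ⟶ A' → (A ∨ B) ⟶ (A' ∨ B)
  ∨ᵣ : ∀ {A B B'} → B ⟶ B' → (A ∨ B) ⟶ (A ∨ B')
  ∀c : ∀ {A A'} → A ⟶ A' → ∀' A ⟶ ∀' A'
  ∃c : ∀ {A A'} → A ⟶ A' → ∃' A ⟶ ∃' A'

_≈_ : Fm → Fm → Set
_≈_ = EqClosure _⟶_

infix 4 _≈_

data Pf : Set where
  hyp    : ℕ → Pf
  lam    : Pf → Pf              -- λα π       (binds proof var 0)
  app    : Pf → Pf → Pf
  pair   : Pf → Pf → Pf
  fst    : Pf → Pf
  snd    : Pf → Pf
  inl    : Pf → Pf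
  inr    : Pf → Pf
  case   : Pf → Pf → Pf → Pf    -- δ(π₁, απ₂, βπ₃)  (π₂, π₃ bind proof var 0)
  unit   : Pf
  abort  : Pf → Pf
  Lam    : Pf → Pf              -- λx π       (binds term var 0)
  App    : Pf → Tm → Pf
  wit    : Tm → Pf → Pf
  unpack : Pf → Pf → Pf         -- δ∃(π, xαπ') (π' binds term var 0 and proof var 0)

subPT : (ℕ → Tm) → Pf → Pf
subPT σ (hyp n)      = hyp n
subPT σ (lam p)      = lam (subPT σ p)
subPT σ (app p q)    = app (subPT σ p) (subPT σ q)
subPT σ (pair p q)   = pair (subPT σ p) (subPT σ q)
subPT σ (fst p)      = fst (subPT σ p)
subPT σ (snd p)      = snd (subPT σ p)
subPT σ (inl p)      = inl (subPT σ p)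
subPT σ (inr p)      = inr (subPT σ p)
subPT σ (case p q r) = case (subPT σ p) (subPT σ q) (subPT σ r)
subPT σ unit         = unit
subPT σ (abort p)    = abort (subPT σ p)
subPT σ (Lam p)      = Lam (subPT (exts σ) p)
subPT σ (App p t)    = App (subPT σ p) (subT σ t)
subPT σ (wit t p)    = wit (subT σ t) (subPT σ p)
subPT σ (unpack p q) = unpack (subPT σ p) (subPT (exts σ) q)

renP : (ℕ → ℕ) → Pf → Pf
renP ρ (hyp n)      = hyp (ρ n)
renP ρ (lam p)      = lam (renP (ext ρ) p)
renP ρ (app p q)    = app (renP ρ p) (renP ρ q)
renP ρ (pair p q)   = pair (renP ρ p) (renP ρ q)
renP ρ (fst p)      = fst (renP ρ p)
renP ρ (snd p)      = snd (renP ρ p)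
renP ρ (inl p)      = inl (renP ρ p)
renP ρ (inr p)      = inr (renP ρ p)
renP ρ (case p q r) = case (renP ρ p) (renP (ext ρ) q) (renP (ext ρ) r)
renP ρ unit         = unit
renP ρ (abort p)    = abort (renP ρ p)
renP ρ (Lam p)      = Lam (renP ρ p)
renP ρ (App p t)    = App (renP ρ p) t
renP ρ (wit t p)    = wit t (renP ρ p)
renP ρ (unpack p q) = unpack (renP ρ p) (renP (ext ρ) q)

extsP : (ℕ → Pf) → ℕ → Pf
extsP τ zero    = hyp zero
extsP τ (suc n) = renP suc (τ n)

liftT : (ℕ → Pf) → ℕ → Pf
liftT τ n = subPT (λ m → var (suc m)) (τ n)

subPP : (ℕ → Pf) → Pf → Pf
subPP τ (hyp n)      = τ n
subPP τ (lam p)      = lam (subPP (extsP τ) p)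
subPP τ (app p q)    = app (subPP τ p) (subPP τ q)
subPP τ (pair p q)   = pair (subPP τ p) (subPP τ q)
subPP τ (fst p)      = fst (subPP τ p)
subPP τ (snd p)      = snd (subPP τ p)
subPP τ (inl p)      = inl (subPP τ p)
subPP τ (inr p)      = inr (subPP τ p)
subPP τ (case p q r) = case (subPP τ p) (subPP (extsP τ) q) (subPP (extsP τ) r)
subPP τ unit         = unit
subPP τ (abort p)    = abort (subPP τ p)
subPP τ (Lam p)      = Lam (subPP (liftT τ) p)
subPP τ (App p t)    = App (subPP τ p) t
subPP τ (wit t p)    = wit t (subPP τ p)
subPP τ (unpack p q) = unpack (subPP τ p) (subPP (extsP (liftT τ)) q)

τ₀ : Pf → ℕ → Pf
τ₀ p zero    = p
τ₀ p (suc n) = hyp n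

data _▷_ : Pf → Pf → Set where
  β⇒   : ∀ p q → app (lam p) q ▷ subPP (τ₀ q) p
  β∀   : ∀ p t → App (Lam p) t ▷ subPT (σ₀ t) p
  β∧₁  : ∀ p q → fst (pair p q) ▷ p
  β∧₂  : ∀ p q → snd (pair p q) ▷ q
  β∨₁  : ∀ p q r → case (inl p) q r ▷ subPP (τ₀ p) q
  β∨₂  : ∀ p q r → case (inr p) q r ▷ subPP (τ₀ p) r
  β∃   : ∀ t p q → unpack (wit t p) q ▷ subPP (τ₀ p) (subPT (σ₀ t) q)
  c-lam    : ∀ {p p'} → p ▷ p' → lam p ▷ lam p'
  c-app₁   : ∀ {p p' q} → p ▷ p' → app p q ▷ app p' q
  c-app₂   : ∀ {p q q'} → q ▷ q' → app p q ▷ app p q'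
  c-pair₁  : ∀ {p p' q} → p ▷ p' → pair p q ▷ pair p' q
  c-pair₂  : ∀ {p q q'} → q ▷ q' → pair p q ▷ pair p q'
  c-fst    : ∀ {p p'} → p ▷ p' → fst p ▷ fst p'
  c-snd    : ∀ {p p'} → p ▷ p' → snd p ▷ snd p'
  c-inl    : ∀ {p p'} → p ▷ p' → inl p ▷ inl p'
  c-inr    : ∀ {p p'} → p ▷ p' → inr p ▷ inr p'
  c-case₁  : ∀ {p p' q r} → p ▷ p' → case p q r ▷ case p' q r
  c-case₂  : ∀ {p q q' r} → q ▷ q' → case p q r ▷ case p q' r
  c-case₃  : ∀ {p q r r'} → r ▷ r' → case p q r ▷ case p q r'
  c-abort  : ∀ {p p'} → p ▷ p' → abort p ▷ abort p'
  c-Lam    : ∀ {p p'} → p ▷ p' → Lam p ▷ Lam p'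
  c-App    : ∀ {p p' t} → p ▷ p' → App p t ▷ App p' t
  c-wit    : ∀ {p p' t} → p ▷ p' → wit t p ▷ wit t p'
  c-unpack₁ : ∀ {p p' q} → p ▷ p' → unpack p q ▷ unpack p' q
  c-unpack₂ : ∀ {p q q'} → q ▷ q' → unpack p q ▷ unpack p q'

Normal : Pf → Set
Normal p = ∀ p' → ¬ (p ▷ p')

Ctx : Set
Ctx = List Fm

data _∋_∶_ : Ctx → ℕ → Fm → Set where
  here  : ∀ {Γ A} → (A ∷ Γ) ∋ zero ∶ A
  there : ∀ {Γ A B n} → Γ ∋ n ∶ A → (B ∷ Γ) ∋ suc n ∶ A

infix 3 _⊢_∶_

data _⊢_∶_ : Ctx → Pf → Fm → Set where
  ax   : ∀ {Γ n A B} → Γ ∋ n ∶ A → A ≈ B → Γ ⊢ hyp n ∶ B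
  ⇒I   : ∀ {Γ p A B C} → (A ∷ Γ) ⊢ p ∶ B → C ≈ (A ⇒ B) → Γ ⊢ lam p ∶ C
  ⇒E   : ∀ {Γ p q A B C} → Γ ⊢ p ∶ C → Γ ⊢ q ∶ A → C ≈ (A ⇒ B) → Γ ⊢ app p q ∶ B
  ∧I   : ∀ {Γ p q A B C} → Γ ⊢ p ∶ A → Γ ⊢ q ∶ B → C ≈ (A ∧ B) → Γ ⊢ pair p q ∶ C
  ∧E₁  : ∀ {Γ p A B C} → Γ ⊢ p ∶ C → C ≈ (A ∧ B) → Γ ⊢ fst p ∶ A
  ∧E₂  : ∀ {Γ p A B C} → Γ ⊢ p ∶ C → C ≈ (A ∧ B) → Γ ⊢ snd p ∶ B
  ∨I₁  : ∀ {Γ p A B C} → Γ ⊢ p ∶ A → C ≈ (A ∨ B) → Γ ⊢ inl p ∶ C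
  ∨I₂  : ∀ {Γ p A B C} → Γ ⊢ p ∶ B → C ≈ (A ∨ B) → Γ ⊢ inr p ∶ C
  ∨E   : ∀ {Γ p q r A B C D} → Γ ⊢ p ∶ C → C ≈ (A ∨ B) →
         (A ∷ Γ) ⊢ q ∶ D → (B ∷ Γ) ⊢ r ∶ D → Γ ⊢ case p q r ∶ D
  ⊤I   : ∀ {Γ A} → A ≈ ⊤' → Γ ⊢ unit ∶ A
  ⊥E   : ∀ {Γ p A B} → Γ ⊢ p ∶ B → B ≈ ⊥' → Γ ⊢ abort p ∶ A
  -- eigenvariable condition handled by de Bruijn shifting of the context
  ∀I   : ∀ {Γ p A B} → map ↑F Γ ⊢ p ∶ A → B ≈ ∀' A → Γ ⊢ Lam p ∶ B
  ∀E   : ∀ {Γ p A B C} t → Γ ⊢ p ∶ B → B ≈ ∀' A → C ≈ (A [ t ]) → Γ ⊢ App p t ∶ C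
  ∃I   : ∀ {Γ p A B C} t → Γ ⊢ p ∶ C → B ≈ ∃' A → C ≈ (A [ t ]) → Γ ⊢ wit t p ∶ B
  ∃E   : ∀ {Γ p q A B C} → Γ ⊢ p ∶ C → C ≈ ∃' A →
         (A ∷ map ↑F Γ) ⊢ q ∶ ↑F B → Γ ⊢ unpack p q ∶ B

Provable : Ctx → Fm → Set
Provable Γ A = ∃ λ p → Γ ⊢ p ∶ A

CutFreeProvable : Ctx → Fm → Set
CutFreeProvable Γ A = ∃ λ p → (Γ ⊢ p ∶ A) × Normal p

-- The proof is normalization by evaluation in a Kripke model of normal
-- derivations.  Worlds are contexts, ordered by renaming hypotheses and term
-- variables; implications and universal statements are interpreted as Kripke
-- function spaces, while disjunctions, existentials and ⊥ may also be
-- interpreted by neutral derivations.  The rule for ε(nat) is not stratified: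
-- ε(nat) reoccurs in its own unfolding, so ε cannot be interpreted by induction
-- along the rewrite system.  Instead ε(u) is interpreted by recursion on the term
-- u, with ε(y → z) a Kripke function space and ε(nat) simply true.  This is
-- sound because the interpretation of ∀p (ε(p) ⇒ (ε(nat) ⇒ ε(p) ⇒ ε(p)) ⇒ ε(p))
-- is inhabited by returning the first argument, and it can be reified because
-- ε(nat) has the normal proof λx λα λβ α.  Thus both rewrite rules preserve the
-- interpretation in both directions, every derivation evaluates to a value, and
-- reading the value back gives a normal derivation of the same sequent, whose
-- erasure is a cut-free proof-term.

module Submission where

open import Defs
open import Data.Nat using (ℕ; zero; suc)
open import Data.List using (_∷_; map)
open import Data.Product using (Σ; _×_; _,_; proj₁; proj₂)
open import Data.Sum using (_⊎_; inj₁; inj₂)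
open import Data.Unit using (⊤; tt)
open import Function using (id) renaming (_∘′_ to _∘_)
open import Relation.Binary.PropositionalEquality using (_≡_; _≗_; refl; sym; trans; cong; cong₂; subst)
import Relation.Binary.Construct.Closure.Equivalence as EqClosure
open import Relation.Binary.Construct.Closure.ReflexiveTransitive using (ε; _◅_)
open import Relation.Binary.Construct.Closure.Symmetric using (fwd; bwd)

variable
  Γ Δ Θ : Ctx
  A B C : Fm
  θ σ : ℕ → Tm
  ρ ρ' : ℕ → ℕ
  n : ℕ

subT-cong : σ ≗ θ → ∀ u → subT σ u ≡ subT θ u
subT-cong e (var n) = e n
subT-cong e nat     = refl
subT-cong e (y ⇛ z) = cong₂ _⇛_ (subT-cong e y) (subT-cong e z)

exts-cong : σ ≗ θ → exts σ ≗ exts θ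
exts-cong e zero    = refl
exts-cong e (suc n) = cong (renT suc) (e n)

subF-cong : σ ≗ θ → ∀ A → subF σ A ≡ subF θ A
subF-cong e (ε t)   = cong ε (subT-cong e t)
subF-cong e (A ⇒ B) = cong₂ _⇒_ (subF-cong e A) (subF-cong e B)
subF-cong e (A ∧ B) = cong₂ _∧_ (subF-cong e A) (subF-cong e B)
subF-cong e (A ∨ B) = cong₂ _∨_ (subF-cong e A) (subF-cong e B)
subF-cong e ⊤'      = refl
subF-cong e ⊥'      = refl
subF-cong e (∀' A)  = cong ∀' (subF-cong (exts-cong e) A)
subF-cong e (∃' A)  = cong ∃' (subF-cong (exts-cong e) A)

subT-id : ∀ u → subT var u ≡ u
subT-id (var n) = refl
subT-id nat     = refl
subT-id (y ⇛ z) = cong₂ _⇛_ (subT-id y) (subT-id z)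

renT-id : ∀ u → renT id u ≡ u
renT-id (var n) = refl
renT-id nat     = refl
renT-id (y ⇛ z) = cong₂ _⇛_ (renT-id y) (renT-id z)

renT-as-subT : ∀ ρ u → renT ρ u ≡ subT (var ∘ ρ) u
renT-as-subT ρ (var n) = refl
renT-as-subT ρ nat     = refl
renT-as-subT ρ (y ⇛ z) = cong₂ _⇛_ (renT-as-subT ρ y) (renT-as-subT ρ z)

renT-renT : ∀ ρ ρ' u → renT ρ (renT ρ' u) ≡ renT (ρ ∘ ρ') u
renT-renT ρ ρ' (var n) = refl
renT-renT ρ ρ' nat     = refl
renT-renT ρ ρ' (y ⇛ z) = cong₂ _⇛_ (renT-renT ρ ρ' y) (renT-renT ρ ρ' z)

subT-renT : ∀ θ ρ u → subT θ (renT ρ u) ≡ subT (θ ∘ ρ) u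
subT-renT θ ρ (var n) = refl
subT-renT θ ρ nat     = refl
subT-renT θ ρ (y ⇛ z) = cong₂ _⇛_ (subT-renT θ ρ y) (subT-renT θ ρ z)

renT-subT : ∀ ρ θ u → renT ρ (subT θ u) ≡ subT (renT ρ ∘ θ) u
renT-subT ρ θ (var n) = refl
renT-subT ρ θ nat     = refl
renT-subT ρ θ (y ⇛ z) = cong₂ _⇛_ (renT-subT ρ θ y) (renT-subT ρ θ z)

subT-subT : ∀ σ θ u → subT θ (subT σ u) ≡ subT (subT θ ∘ σ) u
subT-subT σ θ (var n) = refl
subT-subT σ θ nat     = refl
subT-subT σ θ (y ⇛ z) = cong₂ _⇛_ (subT-subT σ θ y) (subT-subT σ θ z)

exts-id : exts var ≗ var
exts-id zero    = refl
exts-id (suc n) = refl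

exts-subT : ∀ σ θ → subT (exts θ) ∘ exts σ ≗ exts (subT θ ∘ σ)
exts-subT σ θ zero    = refl
exts-subT σ θ (suc n) = trans (subT-renT (exts θ) suc (σ n)) (sym (renT-subT suc θ (σ n)))

subF-id : ∀ A → subF var A ≡ A
subF-id (ε t)   = cong ε (subT-id t)
subF-id (A ⇒ B) = cong₂ _⇒_ (subF-id A) (subF-id B)
subF-id (A ∧ B) = cong₂ _∧_ (subF-id A) (subF-id B)
subF-id (A ∨ B) = cong₂ _∨_ (subF-id A) (subF-id B)
subF-id ⊤'      = refl
subF-id ⊥'      = refl
subF-id (∀' A)  = cong ∀' (trans (subF-cong exts-id A) (subF-id A))
subF-id (∃' A)  = cong ∃' (trans (subF-cong exts-id A) (subF-id A))

subF-subF : ∀ σ θ A → subF θ (subF σ A) ≡ subF (subT θ ∘ σ) A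
subF-subF σ θ (ε t)   = cong ε (subT-subT σ θ t)
subF-subF σ θ (A ⇒ B) = cong₂ _⇒_ (subF-subF σ θ A) (subF-subF σ θ B)
subF-subF σ θ (A ∧ B) = cong₂ _∧_ (subF-subF σ θ A) (subF-subF σ θ B)
subF-subF σ θ (A ∨ B) = cong₂ _∨_ (subF-subF σ θ A) (subF-subF σ θ B)
subF-subF σ θ ⊤'      = refl
subF-subF σ θ ⊥'      = refl
subF-subF σ θ (∀' A)  =
  cong ∀' (trans (subF-subF (exts σ) (exts θ) A) (subF-cong (exts-subT σ θ) A))
subF-subF σ θ (∃' A)  =
  cong ∃' (trans (subF-subF (exts σ) (exts θ) A) (subF-cong (exts-subT σ θ) A))

_∷ₛ_ : Tm → (ℕ → Tm) → ℕ → Tm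
(t ∷ₛ θ) zero    = t
(t ∷ₛ θ) (suc n) = θ n

renF-subF : ∀ ρ θ A → subF (var ∘ ρ) (subF θ A) ≡ subF (renT ρ ∘ θ) A
renF-subF ρ θ A =
  trans (subF-subF θ (var ∘ ρ) A) (subF-cong (λ n → sym (renT-as-subT ρ (θ n))) A)

[]-exts : ∀ t θ A → subF (exts θ) A [ t ] ≡ subF (t ∷ₛ θ) A
[]-exts t θ A = trans (subF-subF (exts θ) (σ₀ t) A) (subF-cong instantiate A)
  where
  instantiate : subT (σ₀ t) ∘ exts θ ≗ t ∷ₛ θ
  instantiate zero    = refl
  instantiate (suc n) = trans (subT-renT (σ₀ t) suc (θ n)) (subT-id (θ n))

subT∘σ₀ : ∀ σ t → subT σ ∘ σ₀ t ≗ subT σ t ∷ₛ σ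
subT∘σ₀ σ t zero    = refl
subT∘σ₀ σ t (suc n) = refl

exts-as-∷ₛ : ∀ θ → var 0 ∷ₛ (renT suc ∘ θ) ≗ exts θ
exts-as-∷ₛ θ zero    = refl
exts-as-∷ₛ θ (suc n) = refl

subF-[] : ∀ σ t A → subF σ (A [ t ]) ≡ subF (exts σ) A [ subT σ t ]
subF-[] σ t A = trans (subF-subF (σ₀ t) σ A)
  (trans (subF-cong (subT∘σ₀ σ t) A) (sym ([]-exts (subT σ t) σ A)))

subF-↑F : ∀ σ A → subF (exts σ) (↑F A) ≡ ↑F (subF σ A)
subF-↑F σ A = trans (subF-subF (var ∘ suc) (exts σ) A)
  (trans (subF-cong (λ n → renT-as-subT suc (σ n)) A) (sym (subF-subF σ (var ∘ suc) A)))

subT-renT-var : ∀ ρ ρ' u → subT (var ∘ ρ) (renT ρ' u) ≡ renT (ρ ∘ ρ') u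
subT-renT-var ρ ρ' u = trans (subT-renT (var ∘ ρ) ρ' u) (sym (renT-as-subT (ρ ∘ ρ') u))

≗-sym : σ ≗ θ → θ ≗ σ
≗-sym e n = sym (e n)

∷ₛ-cong : ∀ t → σ ≗ θ → (t ∷ₛ σ) ≗ (t ∷ₛ θ)
∷ₛ-cong t e zero    = refl
∷ₛ-cong t e (suc n) = e n

renT∘-cong : ∀ ρ → σ ≗ θ → renT ρ ∘ σ ≗ renT ρ ∘ θ
renT∘-cong ρ e n = cong (renT ρ) (e n)

renT-renT∘ : ∀ ρ ρ' (θ : ℕ → Tm) → renT (ρ ∘ ρ') ∘ θ ≗ renT ρ ∘ renT ρ' ∘ θ
renT-renT∘ ρ ρ' θ n = sym (renT-renT ρ ρ' (θ n))

renT-id∘ : ∀ (θ : ℕ → Tm) → renT id ∘ θ ≗ θ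
renT-id∘ θ n = renT-id (θ n)

subT-∘-renT : ∀ (σ θ : ℕ → Tm) ρ → subT (renT ρ ∘ θ) ∘ σ ≗ renT ρ ∘ subT θ ∘ σ
subT-∘-renT σ θ ρ n = sym (renT-subT ρ θ (σ n))

subT-∘-∷ₛ : ∀ (σ θ : ℕ → Tm) t → subT (t ∷ₛ θ) ∘ exts σ ≗ t ∷ₛ (subT θ ∘ σ)
subT-∘-∷ₛ σ θ t zero    = refl
subT-∘-∷ₛ σ θ t (suc n) = subT-renT (t ∷ₛ θ) suc (σ n)

subT-∘-∷ₛ-renT : ∀ (σ θ : ℕ → Tm) ρ t → subT (t ∷ₛ (renT ρ ∘ θ)) ∘ exts σ ≗ t ∷ₛ (renT ρ ∘ subT θ ∘ σ)
subT-∘-∷ₛ-renT σ θ ρ t zero    = refl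
subT-∘-∷ₛ-renT σ θ ρ t (suc n) = trans (subT-∘-∷ₛ σ (renT ρ ∘ θ) t (suc n)) (subT-∘-renT σ θ ρ n)

≈-refl : A ≈ A
≈-refl = EqClosure.reflexive _⟶_

≈-sym : A ≈ B → B ≈ A
≈-sym = EqClosure.symmetric _⟶_

≈-trans : A ≈ B → B ≈ C → A ≈ C
≈-trans = EqClosure.transitive _⟶_

≡⇒≈ : A ≡ B → A ≈ B
≡⇒≈ refl = ≈-refl

⟶⇒≈ : A ⟶ B → A ≈ B
⟶⇒≈ = EqClosure.return

⟶-subF : ∀ σ → A ⟶ B → subF σ A ⟶ subF σ B
⟶-subF σ r-nat       = r-nat
⟶-subF σ (r-arr y z) = r-arr _ _
⟶-subF σ (⇒ₗ r)      = ⇒ₗ (⟶-subF σ r)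
⟶-subF σ (⇒ᵣ r)      = ⇒ᵣ (⟶-subF σ r)
⟶-subF σ (∧ₗ r)      = ∧ₗ (⟶-subF σ r)
⟶-subF σ (∧ᵣ r)      = ∧ᵣ (⟶-subF σ r)
⟶-subF σ (∨ₗ r)      = ∨ₗ (⟶-subF σ r)
⟶-subF σ (∨ᵣ r)      = ∨ᵣ (⟶-subF σ r)
⟶-subF σ (∀c r)      = ∀c (⟶-subF (exts σ) r)
⟶-subF σ (∃c r)      = ∃c (⟶-subF (exts σ) r)

≈-subF : ∀ σ → A ≈ B → subF σ A ≈ subF σ B
≈-subF σ = EqClosure.gmap (subF σ) (⟶-subF σ)

≈-⇒ʳ : B ≈ C → (A ⇒ B) ≈ (A ⇒ C)
≈-⇒ʳ {A = A} = EqClosure.gmap (A ⇒_) ⇒ᵣ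

≈-∧ˡ : A ≈ C → (A ∧ B) ≈ (C ∧ B)
≈-∧ˡ {B = B} = EqClosure.gmap (_∧ B) ∧ₗ

≈-∧ʳ : B ≈ C → (A ∧ B) ≈ (A ∧ C)
≈-∧ʳ {A = A} = EqClosure.gmap (A ∧_) ∧ᵣ

-- Normal derivations

data Ne : Ctx → Fm → Set
data Nf : Ctx → Fm → Set

data Ne where
  hyp    : Γ ∋ n ∶ A → A ≈ B → Ne Γ B
  app    : Ne Γ C → Nf Γ A → C ≈ (A ⇒ B) → Ne Γ B
  fst    : Ne Γ C → C ≈ (A ∧ B) → Ne Γ A
  snd    : Ne Γ C → C ≈ (A ∧ B) → Ne Γ B
  case   : ∀ {D} → Ne Γ C → C ≈ (A ∨ B) → Nf (A ∷ Γ) D → Nf (B ∷ Γ) D → Ne Γ D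
  abort  : Ne Γ B → B ≈ ⊥' → Ne Γ A
  App    : ∀ t → Ne Γ B → B ≈ ∀' A → C ≈ A [ t ] → Ne Γ C
  unpack : Ne Γ C → C ≈ ∃' A → Nf (A ∷ map ↑F Γ) (↑F B) → Ne Γ B

data Nf where
  ne   : Ne Γ A → Nf Γ A
  lam  : Nf (A ∷ Γ) B → C ≈ (A ⇒ B) → Nf Γ C
  pair : Nf Γ A → Nf Γ B → C ≈ (A ∧ B) → Nf Γ C
  inl  : Nf Γ A → C ≈ (A ∨ B) → Nf Γ C
  inr  : Nf Γ B → C ≈ (A ∨ B) → Nf Γ C
  unit : A ≈ ⊤' → Nf Γ A
  Lam  : Nf (map ↑F Γ) A → B ≈ ∀' A → Nf Γ B
  wit  : ∀ t → Nf Γ C → B ≈ ∃' A → C ≈ A [ t ] → Nf Γ B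

eraseNe : Ne Γ A → Pf
eraseNf : Nf Γ A → Pf
eraseNe (hyp {n = n} _ _)  = hyp n
eraseNe (app d e _)        = app (eraseNe d) (eraseNf e)
eraseNe (fst d _)          = fst (eraseNe d)
eraseNe (snd d _)          = snd (eraseNe d)
eraseNe (case d _ e f)     = case (eraseNe d) (eraseNf e) (eraseNf f)
eraseNe (abort d _)        = abort (eraseNe d)
eraseNe (App t d _ _)      = App (eraseNe d) t
eraseNe (unpack d _ e)     = unpack (eraseNe d) (eraseNf e)
eraseNf (ne d)             = eraseNe d
eraseNf (lam d _)          = lam (eraseNf d)
eraseNf (pair d e _)       = pair (eraseNf d) (eraseNf e)
eraseNf (inl d _)          = inl (eraseNf d)
eraseNf (inr d _)          = inr (eraseNf d)
eraseNf (unit _)           = unit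
eraseNf (Lam d _)          = Lam (eraseNf d)
eraseNf (wit t d _ _)      = wit t (eraseNf d)

eraseNe-⊢ : (d : Ne Γ A) → Γ ⊢ eraseNe d ∶ A
eraseNf-⊢ : (d : Nf Γ A) → Γ ⊢ eraseNf d ∶ A
eraseNe-⊢ (hyp x c)          = ax x c
eraseNe-⊢ (app d e c)        = ⇒E (eraseNe-⊢ d) (eraseNf-⊢ e) c
eraseNe-⊢ (fst d c)          = ∧E₁ (eraseNe-⊢ d) c
eraseNe-⊢ (snd d c)          = ∧E₂ (eraseNe-⊢ d) c
eraseNe-⊢ (case d c e f)     = ∨E (eraseNe-⊢ d) c (eraseNf-⊢ e) (eraseNf-⊢ f)
eraseNe-⊢ (abort d c)        = ⊥E (eraseNe-⊢ d) c
eraseNe-⊢ (App t d c c')     = ∀E t (eraseNe-⊢ d) c c'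
eraseNe-⊢ (unpack d c e)     = ∃E (eraseNe-⊢ d) c (eraseNf-⊢ e)
eraseNf-⊢ (ne d)             = eraseNe-⊢ d
eraseNf-⊢ (lam d c)          = ⇒I (eraseNf-⊢ d) c
eraseNf-⊢ (pair d e c)       = ∧I (eraseNf-⊢ d) (eraseNf-⊢ e) c
eraseNf-⊢ (inl d c)          = ∨I₁ (eraseNf-⊢ d) c
eraseNf-⊢ (inr d c)          = ∨I₂ (eraseNf-⊢ d) c
eraseNf-⊢ (unit c)           = ⊤I c
eraseNf-⊢ (Lam d c)          = ∀I (eraseNf-⊢ d) c
eraseNf-⊢ (wit t d c c')     = ∃I t (eraseNf-⊢ d) c c'

data IsNe : Pf → Set
data IsNf : Pf → Set

data IsNe where
  hyp    : ∀ n → IsNe (hyp n)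
  app    : ∀ {p q} → IsNe p → IsNf q → IsNe (app p q)
  fst    : ∀ {p} → IsNe p → IsNe (fst p)
  snd    : ∀ {p} → IsNe p → IsNe (snd p)
  case   : ∀ {p q r} → IsNe p → IsNf q → IsNf r → IsNe (case p q r)
  abort  : ∀ {p} → IsNe p → IsNe (abort p)
  App    : ∀ {p} t → IsNe p → IsNe (App p t)
  unpack : ∀ {p q} → IsNe p → IsNf q → IsNe (unpack p q)

data IsNf where
  ne   : ∀ {p} → IsNe p → IsNf p
  lam  : ∀ {p} → IsNf p → IsNf (lam p)
  pair : ∀ {p q} → IsNf p → IsNf q → IsNf (pair p q)
  inl  : ∀ {p} → IsNf p → IsNf (inl p)
  inr  : ∀ {p} → IsNf p → IsNf (inr p)
  unit : IsNf unit
  Lam  : ∀ {p} → IsNf p → IsNf (Lam p)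
  wit  : ∀ {p} t → IsNf p → IsNf (wit t p)

IsNe⇒Normal : ∀ {p} → IsNe p → Normal p
IsNf⇒Normal : ∀ {p} → IsNf p → Normal p
IsNe⇒Normal (hyp n) _ ()
IsNe⇒Normal (app () _)      _ (β⇒ _ _)
IsNe⇒Normal (app n _)       _ (c-app₁ r)    = IsNe⇒Normal n _ r
IsNe⇒Normal (app _ m)       _ (c-app₂ r)    = IsNf⇒Normal m _ r
IsNe⇒Normal (fst ())        _ (β∧₁ _ _)
IsNe⇒Normal (fst n)         _ (c-fst r)     = IsNe⇒Normal n _ r
IsNe⇒Normal (snd ())        _ (β∧₂ _ _)
IsNe⇒Normal (snd n)         _ (c-snd r)     = IsNe⇒Normal n _ r
IsNe⇒Normal (case () _ _)   _ (β∨₁ _ _ _)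
IsNe⇒Normal (case () _ _)   _ (β∨₂ _ _ _)
IsNe⇒Normal (case n _ _)    _ (c-case₁ r)   = IsNe⇒Normal n _ r
IsNe⇒Normal (case _ m _)    _ (c-case₂ r)   = IsNf⇒Normal m _ r
IsNe⇒Normal (case _ _ m)    _ (c-case₃ r)   = IsNf⇒Normal m _ r
IsNe⇒Normal (abort n)       _ (c-abort r)   = IsNe⇒Normal n _ r
IsNe⇒Normal (App _ ())      _ (β∀ _ _)
IsNe⇒Normal (App _ n)       _ (c-App r)     = IsNe⇒Normal n _ r
IsNe⇒Normal (unpack () _)   _ (β∃ _ _ _)
IsNe⇒Normal (unpack n _)    _ (c-unpack₁ r) = IsNe⇒Normal n _ r
IsNe⇒Normal (unpack _ m)    _ (c-unpack₂ r) = IsNf⇒Normal m _ r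
IsNf⇒Normal (ne n)                          = IsNe⇒Normal n
IsNf⇒Normal (lam m)         _ (c-lam r)     = IsNf⇒Normal m _ r
IsNf⇒Normal (pair m _)      _ (c-pair₁ r)   = IsNf⇒Normal m _ r
IsNf⇒Normal (pair _ m)      _ (c-pair₂ r)   = IsNf⇒Normal m _ r
IsNf⇒Normal (inl m)         _ (c-inl r)     = IsNf⇒Normal m _ r
IsNf⇒Normal (inr m)         _ (c-inr r)     = IsNf⇒Normal m _ r
IsNf⇒Normal unit            _ ()
IsNf⇒Normal (Lam m)         _ (c-Lam r)     = IsNf⇒Normal m _ r
IsNf⇒Normal (wit _ m)       _ (c-wit r)     = IsNf⇒Normal m _ r

eraseNe-IsNe : (d : Ne Γ A) → IsNe (eraseNe d)
eraseNf-IsNf : (d : Nf Γ A) → IsNf (eraseNf d)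
eraseNe-IsNe (hyp {n = n} _ _) = hyp n
eraseNe-IsNe (app d e _)       = app (eraseNe-IsNe d) (eraseNf-IsNf e)
eraseNe-IsNe (fst d _)         = fst (eraseNe-IsNe d)
eraseNe-IsNe (snd d _)         = snd (eraseNe-IsNe d)
eraseNe-IsNe (case d _ e f)    = case (eraseNe-IsNe d) (eraseNf-IsNf e) (eraseNf-IsNf f)
eraseNe-IsNe (abort d _)       = abort (eraseNe-IsNe d)
eraseNe-IsNe (App t d _ _)     = App t (eraseNe-IsNe d)
eraseNe-IsNe (unpack d _ e)    = unpack (eraseNe-IsNe d) (eraseNf-IsNf e)
eraseNf-IsNf (ne d)            = ne (eraseNe-IsNe d)
eraseNf-IsNf (lam d _)         = lam (eraseNf-IsNf d)
eraseNf-IsNf (pair d e _)      = pair (eraseNf-IsNf d) (eraseNf-IsNf e)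
eraseNf-IsNf (inl d _)         = inl (eraseNf-IsNf d)
eraseNf-IsNf (inr d _)         = inr (eraseNf-IsNf d)
eraseNf-IsNf (unit _)          = unit
eraseNf-IsNf (Lam d _)         = Lam (eraseNf-IsNf d)
eraseNf-IsNf (wit t d _ _)     = wit t (eraseNf-IsNf d)

Ne-conv : Ne Γ A → A ≈ B → Ne Γ B
Nf-conv : Nf Γ A → A ≈ B → Nf Γ B
Ne-conv (hyp x c)        c' = hyp x (≈-trans c c')
Ne-conv (app d e c)      c' = app d e (≈-trans c (≈-⇒ʳ c'))
Ne-conv (fst d c)        c' = fst d (≈-trans c (≈-∧ˡ c'))
Ne-conv (snd d c)        c' = snd d (≈-trans c (≈-∧ʳ c'))
Ne-conv (case d c e f)   c' = case d c (Nf-conv e c') (Nf-conv f c')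
Ne-conv (abort d c)      c' = abort d c
Ne-conv (App t d c c₁)   c' = App t d c (≈-trans (≈-sym c') c₁)
Ne-conv (unpack d c e)   c' = unpack d c (Nf-conv e (≈-subF _ c'))
Nf-conv (ne d)           c' = ne (Ne-conv d c')
Nf-conv (lam d c)        c' = lam d (≈-trans (≈-sym c') c)
Nf-conv (pair d e c)     c' = pair d e (≈-trans (≈-sym c') c)
Nf-conv (inl d c)        c' = inl d (≈-trans (≈-sym c') c)
Nf-conv (inr d c)        c' = inr d (≈-trans (≈-sym c') c)
Nf-conv (unit c)         c' = unit (≈-trans (≈-sym c') c)
Nf-conv (Lam d c)        c' = Lam d (≈-trans (≈-sym c') c)
Nf-conv (wit t d c c₁)   c' = wit t d (≈-trans (≈-sym c') c) c₁

Ren : Ctx → Ctx → (ℕ → Tm) → Set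
Ren Γ Δ σ = ∀ {n A} → Γ ∋ n ∶ A → Σ ℕ λ m → Δ ∋ m ∶ subF σ A

∋-map : ∀ {f : Fm → Fm} → Γ ∋ n ∶ A → map f Γ ∋ n ∶ f A
∋-map here      = here
∋-map (there x) = there (∋-map x)

∋-map⁻ : ∀ {f : Fm → Fm} Γ → map f Γ ∋ n ∶ B → Σ Fm λ A → Γ ∋ n ∶ A × B ≡ f A
∋-map⁻ (A ∷ Γ) here = A , here , refl
∋-map⁻ (A ∷ Γ) (there x) with ∋-map⁻ Γ x
... | C , y , eq = C , there y , eq

Ren-∷ : Ren Γ Δ σ → Ren (A ∷ Γ) (subF σ A ∷ Δ) σ
Ren-∷ r here      = zero , here
Ren-∷ r (there x) with r x
... | m , y = suc m , there y

Ren-↑F : Ren Γ Δ σ → Ren (map ↑F Γ) (map ↑F Δ) (exts σ)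
Ren-↑F {Γ = Γ} {Δ = Δ} {σ = σ} r x with ∋-map⁻ Γ x
... | A , y , refl with r y
... | m , z = m , subst (map ↑F Δ ∋ m ∶_) (sym (subF-↑F σ A)) (∋-map z)

Ne-ren : ∀ σ → Ren Γ Δ σ → Ne Γ A → Ne Δ (subF σ A)
Nf-ren : ∀ σ → Ren Γ Δ σ → Nf Γ A → Nf Δ (subF σ A)
Ne-ren σ r (hyp x c) = hyp (proj₂ (r x)) (≈-subF σ c)
Ne-ren σ r (app d e c) = app (Ne-ren σ r d) (Nf-ren σ r e) (≈-subF σ c)
Ne-ren σ r (fst d c) = fst (Ne-ren σ r d) (≈-subF σ c)
Ne-ren σ r (snd d c) = snd (Ne-ren σ r d) (≈-subF σ c)
Ne-ren σ r (case d c e f) =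
  case (Ne-ren σ r d) (≈-subF σ c) (Nf-ren σ (Ren-∷ r) e) (Nf-ren σ (Ren-∷ r) f)
Ne-ren σ r (abort d c) = abort (Ne-ren σ r d) (≈-subF σ c)
Ne-ren σ r (App {A = A} t d c c') =
  App (subT σ t) (Ne-ren σ r d) (≈-subF σ c) (≈-trans (≈-subF σ c') (≡⇒≈ (subF-[] σ t A)))
Ne-ren σ r (unpack {B = B} d c e) =
  unpack (Ne-ren σ r d) (≈-subF σ c) (subst (Nf _) (subF-↑F σ B) (Nf-ren (exts σ) (Ren-∷ (Ren-↑F r)) e))
Nf-ren σ r (ne d) = ne (Ne-ren σ r d)
Nf-ren σ r (lam d c) = lam (Nf-ren σ (Ren-∷ r) d) (≈-subF σ c)
Nf-ren σ r (pair d e c) = pair (Nf-ren σ r d) (Nf-ren σ r e) (≈-subF σ c)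
Nf-ren σ r (inl d c) = inl (Nf-ren σ r d) (≈-subF σ c)
Nf-ren σ r (inr d c) = inr (Nf-ren σ r d) (≈-subF σ c)
Nf-ren σ r (unit c) = unit (≈-subF σ c)
Nf-ren σ r (Lam d c) = Lam (Nf-ren (exts σ) (Ren-↑F r) d) (≈-subF σ c)
Nf-ren σ r (wit {A = A} t d c c') =
  wit (subT σ t) (Nf-ren σ r d) (≈-subF σ c) (≈-trans (≈-subF σ c') (≡⇒≈ (subF-[] σ t A)))

_≤_ : Ctx → Ctx → Set
Γ ≤ Δ = Σ (ℕ → ℕ) λ ρ → Ren Γ Δ (var ∘ ρ)

⌊_⌋ : Γ ≤ Δ → ℕ → ℕ
⌊_⌋ = proj₁

≤-refl : Γ ≤ Γ
≤-refl {Γ} = id , λ {n} {A} x → n , subst (Γ ∋ n ∶_) (sym (subF-id A)) x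

≤-trans : Γ ≤ Δ → Δ ≤ Θ → Γ ≤ Θ
≤-trans {Γ} {Δ} {Θ} (ρ₁ , r₁) (ρ₂ , r₂) = ρ₂ ∘ ρ₁ , r
  where
  r : Ren Γ Θ (var ∘ ρ₂ ∘ ρ₁)
  r {A = A} x with r₁ x
  ... | m , y with r₂ y
  ... | k , z = k , subst (Θ ∋ k ∶_) (subF-subF (var ∘ ρ₁) (var ∘ ρ₂) A) z

≤-∷ : Γ ≤ (A ∷ Γ)
≤-∷ {Γ} = id , λ {n} {B} x → suc n , there (subst (Γ ∋ n ∶_) (sym (subF-id B)) x)

≤-↑F : Γ ≤ map ↑F Γ
≤-↑F = suc , λ {n} x → n , ∋-map x

Ne-mono : (w : Γ ≤ Δ) → Ne Γ A → Ne Δ (subF (var ∘ ⌊ w ⌋) A)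
Ne-mono (ρ , r) = Ne-ren (var ∘ ρ) r

Nf-mono : (w : Γ ≤ Δ) → Nf Γ A → Nf Δ (subF (var ∘ ⌊ w ⌋) A)
Nf-mono (ρ , r) = Nf-ren (var ∘ ρ) r

-- The Kripke model of normal derivations

-- El ρ Γ u interprets ε (renT ρ u); carrying ρ instead of renaming u keeps the
-- definition structural in u.
El : (ℕ → ℕ) → Ctx → Tm → Set
El ρ Γ (var n) = Nf Γ (ε (var (ρ n)))
El ρ Γ nat     = ⊤
El ρ Γ (y ⇛ z) = ∀ {Δ} (w : Γ ≤ Δ) → El (⌊ w ⌋ ∘ ρ) Δ y → El (⌊ w ⌋ ∘ ρ) Δ z

El-mono : ∀ u (w : Γ ≤ Δ) → El ρ Γ u → El (⌊ w ⌋ ∘ ρ) Δ u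
El-mono (var n) w d = Nf-mono w d
El-mono nat     w _ = tt
El-mono (y ⇛ z) w f = λ w' → f (≤-trans w w')

El-renT  : ∀ u → El (ρ ∘ ρ') Γ u → El ρ Γ (renT ρ' u)
El-renT⁻ : ∀ u → El ρ Γ (renT ρ' u) → El (ρ ∘ ρ') Γ u
El-renT  (var n) e = e
El-renT  nat     e = e
El-renT  (y ⇛ z) f = λ w e → El-renT z (f w (El-renT⁻ y e))
El-renT⁻ (var n) e = e
El-renT⁻ nat     e = e
El-renT⁻ (y ⇛ z) f = λ w e → El-renT⁻ z (f w (El-renT y e))

natNf : Nf Γ (ε nat)
natNf = Lam (lam (lam (ne (hyp (there here) ≈-refl)) ≈-refl) ≈-refl) (⟶⇒≈ r-nat)

reflectEl : ∀ ρ u → Ne Γ (ε (renT ρ u)) → El ρ Γ u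
reifyEl   : ∀ ρ u → El ρ Γ u → Nf Γ (ε (renT ρ u))
reflectEl ρ (var n) d = ne d
reflectEl ρ nat     d = tt
reflectEl ρ (y ⇛ z) d w e = reflectEl _ z (app (Ne-mono w d) (reifyEl _ y e) unfold)
  where
  unfold : subF (var ∘ ⌊ w ⌋) (ε (renT ρ (y ⇛ z))) ≈ (ε (renT (⌊ w ⌋ ∘ ρ) y) ⇒ ε (renT (⌊ w ⌋ ∘ ρ) z))
  unfold = ≈-trans (≡⇒≈ (cong₂ (λ a b → ε (a ⇛ b)) (subT-renT-var ⌊ w ⌋ ρ y) (subT-renT-var ⌊ w ⌋ ρ z)))
                   (⟶⇒≈ (r-arr _ _))
reifyEl ρ (var n) e = e
reifyEl ρ nat     _ = natNf
reifyEl ρ (y ⇛ z) f = lam (reifyEl _ z (f ≤-∷ (reflectEl _ y (hyp here ≈-refl)))) (⟶⇒≈ (r-arr _ _))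

Val : (ℕ → Tm) → Ctx → Fm → Set
Val θ Γ (ε u)   = El id Γ (subT θ u)
Val θ Γ (A ⇒ B) = ∀ {Δ} (w : Γ ≤ Δ) → Val (renT ⌊ w ⌋ ∘ θ) Δ A → Val (renT ⌊ w ⌋ ∘ θ) Δ B
Val θ Γ (A ∧ B) = Val θ Γ A × Val θ Γ B
Val θ Γ (A ∨ B) = (Val θ Γ A ⊎ Val θ Γ B) ⊎ Ne Γ (subF θ (A ∨ B))
Val θ Γ ⊤'      = ⊤
Val θ Γ ⊥'      = Ne Γ ⊥'
Val θ Γ (∀' A)  = ∀ {Δ} (w : Γ ≤ Δ) t → Val (t ∷ₛ (renT ⌊ w ⌋ ∘ θ)) Δ A
Val θ Γ (∃' A)  = (Σ Tm λ t → Val (t ∷ₛ θ) Γ A) ⊎ Ne Γ (subF θ (∃' A))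

Val-cong : ∀ A → σ ≗ θ → Val σ Γ A → Val θ Γ A
Val-cong (ε u)   e v = subst (El id _) (subT-cong e u) v
Val-cong (A ⇒ B) e f = λ w a →
  Val-cong B (renT∘-cong _ e) (f w (Val-cong A (renT∘-cong _ (≗-sym e)) a))
Val-cong (A ∧ B) e (a , b)          = Val-cong A e a , Val-cong B e b
Val-cong (A ∨ B) e (inj₁ (inj₁ a))  = inj₁ (inj₁ (Val-cong A e a))
Val-cong (A ∨ B) e (inj₁ (inj₂ b))  = inj₁ (inj₂ (Val-cong B e b))
Val-cong (A ∨ B) e (inj₂ d)         = inj₂ (subst (Ne _) (subF-cong e (A ∨ B)) d)
Val-cong ⊤'      e v = v
Val-cong ⊥'      e v = v
Val-cong (∀' A)  e f = λ w t → Val-cong A (∷ₛ-cong t (renT∘-cong _ e)) (f w t)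
Val-cong (∃' A)  e (inj₁ (t , v))   = inj₁ (t , Val-cong A (∷ₛ-cong t e) v)
Val-cong (∃' A)  e (inj₂ d)         = inj₂ (subst (Ne _) (subF-cong e (∃' A)) d)

Val-mono : ∀ A (w : Γ ≤ Δ) → Val θ Γ A → Val (renT ⌊ w ⌋ ∘ θ) Δ A
Val-mono {θ = θ} (ε u) w e =
  subst (El id _) (renT-subT ⌊ w ⌋ θ u) (El-renT (subT θ u) (El-mono (subT θ u) w e))
Val-mono {θ = θ} (A ⇒ B) w f = λ w' a →
  Val-cong B (renT-renT∘ ⌊ w' ⌋ ⌊ w ⌋ θ)
    (f (≤-trans w w') (Val-cong A (≗-sym (renT-renT∘ ⌊ w' ⌋ ⌊ w ⌋ θ)) a))
Val-mono (A ∧ B) w (a , b)         = Val-mono A w a , Val-mono B w b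
Val-mono (A ∨ B) w (inj₁ (inj₁ a)) = inj₁ (inj₁ (Val-mono A w a))
Val-mono (A ∨ B) w (inj₁ (inj₂ b)) = inj₁ (inj₂ (Val-mono B w b))
Val-mono {θ = θ} (A ∨ B) w (inj₂ d) = inj₂ (subst (Ne _) (renF-subF ⌊ w ⌋ θ (A ∨ B)) (Ne-mono w d))
Val-mono ⊤'      w _ = tt
Val-mono ⊥'      w d = Ne-mono w d
Val-mono {θ = θ} (∀' A) w f = λ w' t →
  Val-cong A (∷ₛ-cong t (renT-renT∘ ⌊ w' ⌋ ⌊ w ⌋ θ)) (f (≤-trans w w') t)
Val-mono {θ = θ} (∃' A) w (inj₁ (t , v)) = inj₁ (renT ⌊ w ⌋ t , Val-cong A renT-∷ₛ (Val-mono A w v))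
  where
  renT-∷ₛ : renT ⌊ w ⌋ ∘ (t ∷ₛ θ) ≗ renT ⌊ w ⌋ t ∷ₛ (renT ⌊ w ⌋ ∘ θ)
  renT-∷ₛ zero    = refl
  renT-∷ₛ (suc n) = refl
Val-mono {θ = θ} (∃' A) w (inj₂ d) = inj₂ (subst (Ne _) (renF-subF ⌊ w ⌋ θ (∃' A)) (Ne-mono w d))

reflect : ∀ A → Ne Γ (subF θ A) → Val θ Γ A
reify   : ∀ A → Val θ Γ A → Nf Γ (subF θ A)
reflect {θ = θ} (ε u) d = reflectEl id (subT θ u) (subst (Ne _) (cong ε (sym (renT-id _))) d)
reflect {θ = θ} (A ⇒ B) d w a =
  reflect B (app (subst (Ne _) (renF-subF ⌊ w ⌋ θ (A ⇒ B)) (Ne-mono w d)) (reify A a) ≈-refl)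
reflect (A ∧ B) d = reflect A (fst d ≈-refl) , reflect B (snd d ≈-refl)
reflect (A ∨ B) d = inj₂ d
reflect ⊤'      d = tt
reflect ⊥'      d = d
reflect {θ = θ} (∀' A) d w t = reflect A
  (App t (subst (Ne _) (renF-subF ⌊ w ⌋ θ (∀' A)) (Ne-mono w d)) ≈-refl
     (≡⇒≈ (sym ([]-exts t (renT ⌊ w ⌋ ∘ θ) A))))
reflect (∃' A) d = inj₂ d
reify {θ = θ} (ε u) e = subst (Nf _) (cong ε (renT-id _)) (reifyEl id (subT θ u) e)
reify {θ = θ} (A ⇒ B) f = lam (subst (Nf _) (subF-cong (renT-id∘ θ) B) (reify B (f ≤-∷ fresh))) ≈-refl
  where
  fresh : Val (renT id ∘ θ) (subF θ A ∷ _) A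
  fresh = reflect A (subst (Ne _) (subF-cong (≗-sym (renT-id∘ θ)) A) (hyp here ≈-refl))
reify (A ∧ B) (a , b)         = pair (reify A a) (reify B b) ≈-refl
reify (A ∨ B) (inj₁ (inj₁ a)) = inl (reify A a) ≈-refl
reify (A ∨ B) (inj₁ (inj₂ b)) = inr (reify B b) ≈-refl
reify (A ∨ B) (inj₂ d)        = ne d
reify ⊤'      _ = unit ≈-refl
reify ⊥'      d = ne d
reify {θ = θ} (∀' A) f =
  Lam (subst (Nf _) (subF-cong (exts-as-∷ₛ θ) A) (reify A (f ≤-↑F (var 0)))) ≈-refl
reify {θ = θ} (∃' A) (inj₁ (t , v)) = wit t (reify A v) ≈-refl (≡⇒≈ (sym ([]-exts t θ A)))
reify (∃' A) (inj₂ d) = ne d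

Val-subF  : ∀ σ A → Val θ Γ (subF σ A) → Val (subT θ ∘ σ) Γ A
Val-subF⁻ : ∀ σ A → Val (subT θ ∘ σ) Γ A → Val θ Γ (subF σ A)
Val-subF {θ = θ} σ (ε u) v = subst (El id _) (subT-subT σ θ u) v
Val-subF {θ = θ} σ (A ⇒ B) f w a =
  Val-cong B (subT-∘-renT σ θ ⌊ w ⌋)
    (Val-subF σ B (f w (Val-subF⁻ σ A (Val-cong A (≗-sym (subT-∘-renT σ θ ⌊ w ⌋)) a))))
Val-subF σ (A ∧ B) (a , b)         = Val-subF σ A a , Val-subF σ B b
Val-subF σ (A ∨ B) (inj₁ (inj₁ a)) = inj₁ (inj₁ (Val-subF σ A a))
Val-subF σ (A ∨ B) (inj₁ (inj₂ b)) = inj₁ (inj₂ (Val-subF σ B b))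
Val-subF {θ = θ} σ (A ∨ B) (inj₂ d) = inj₂ (subst (Ne _) (subF-subF σ θ (A ∨ B)) d)
Val-subF σ ⊤' v = v
Val-subF σ ⊥' v = v
Val-subF {θ = θ} σ (∀' A) f w t = Val-cong A (subT-∘-∷ₛ-renT σ θ ⌊ w ⌋ t) (Val-subF (exts σ) A (f w t))
Val-subF {θ = θ} σ (∃' A) (inj₁ (t , v)) = inj₁ (t , Val-cong A (subT-∘-∷ₛ σ θ t) (Val-subF (exts σ) A v))
Val-subF {θ = θ} σ (∃' A) (inj₂ d) = inj₂ (subst (Ne _) (subF-subF σ θ (∃' A)) d)
Val-subF⁻ {θ = θ} σ (ε u) v = subst (El id _) (sym (subT-subT σ θ u)) v
Val-subF⁻ {θ = θ} σ (A ⇒ B) f w a =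
  Val-subF⁻ σ B (Val-cong B (≗-sym (subT-∘-renT σ θ ⌊ w ⌋))
    (f w (Val-cong A (subT-∘-renT σ θ ⌊ w ⌋) (Val-subF σ A a))))
Val-subF⁻ σ (A ∧ B) (a , b)         = Val-subF⁻ σ A a , Val-subF⁻ σ B b
Val-subF⁻ σ (A ∨ B) (inj₁ (inj₁ a)) = inj₁ (inj₁ (Val-subF⁻ σ A a))
Val-subF⁻ σ (A ∨ B) (inj₁ (inj₂ b)) = inj₁ (inj₂ (Val-subF⁻ σ B b))
Val-subF⁻ {θ = θ} σ (A ∨ B) (inj₂ d) = inj₂ (subst (Ne _) (sym (subF-subF σ θ (A ∨ B))) d)
Val-subF⁻ σ ⊤' v = v
Val-subF⁻ σ ⊥' v = v
Val-subF⁻ {θ = θ} σ (∀' A) f w t =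
  Val-subF⁻ (exts σ) A (Val-cong A (≗-sym (subT-∘-∷ₛ-renT σ θ ⌊ w ⌋ t)) (f w t))
Val-subF⁻ {θ = θ} σ (∃' A) (inj₁ (t , v)) =
  inj₁ (t , Val-subF⁻ (exts σ) A (Val-cong A (≗-sym (subT-∘-∷ₛ σ θ t)) v))
Val-subF⁻ {θ = θ} σ (∃' A) (inj₂ d) = inj₂ (subst (Ne _) (sym (subF-subF σ θ (∃' A))) d)

Val-⟶ : A ⟶ B → Val θ Γ A → Val θ Γ B
Val-⟵ : A ⟶ B → Val θ Γ B → Val θ Γ A
Val-⟶ {θ = θ} r-nat _ w t w₁ x w₂ _ =
  Val-mono {θ = renT ⌊ w₁ ⌋ ∘ (t ∷ₛ (renT ⌊ w ⌋ ∘ θ))} (ε (var 0)) w₂ x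
Val-⟶ {θ = θ} (r-arr y z) e w a =
  subst (El id _) (renT-subT ⌊ w ⌋ θ z)
    (El-renT (subT θ z) (e w (El-renT⁻ (subT θ y) (subst (El id _) (sym (renT-subT ⌊ w ⌋ θ y)) a))))
Val-⟶ (⇒ₗ r) f w a = f w (Val-⟵ r a)
Val-⟶ (⇒ᵣ r) f w a = Val-⟶ r (f w a)
Val-⟶ (∧ₗ r) (a , b) = Val-⟶ r a , b
Val-⟶ (∧ᵣ r) (a , b) = a , Val-⟶ r b
Val-⟶ (∨ₗ r) (inj₁ (inj₁ a)) = inj₁ (inj₁ (Val-⟶ r a))
Val-⟶ (∨ₗ r) (inj₁ (inj₂ b)) = inj₁ (inj₂ b)
Val-⟶ {θ = θ} (∨ₗ r) (inj₂ d) = inj₂ (Ne-conv d (⟶⇒≈ (⟶-subF θ (∨ₗ r))))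
Val-⟶ (∨ᵣ r) (inj₁ (inj₁ a)) = inj₁ (inj₁ a)
Val-⟶ (∨ᵣ r) (inj₁ (inj₂ b)) = inj₁ (inj₂ (Val-⟶ r b))
Val-⟶ {θ = θ} (∨ᵣ r) (inj₂ d) = inj₂ (Ne-conv d (⟶⇒≈ (⟶-subF θ (∨ᵣ r))))
Val-⟶ (∀c r) f w t = Val-⟶ r (f w t)
Val-⟶ (∃c r) (inj₁ (t , v)) = inj₁ (t , Val-⟶ r v)
Val-⟶ {θ = θ} (∃c r) (inj₂ d) = inj₂ (Ne-conv d (⟶⇒≈ (⟶-subF θ (∃c r))))
Val-⟵ r-nat _ = tt
Val-⟵ {θ = θ} (r-arr y z) f w a =
  El-renT⁻ (subT θ z) (subst (El id _) (sym (renT-subT ⌊ w ⌋ θ z))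
    (f w (subst (El id _) (renT-subT ⌊ w ⌋ θ y) (El-renT (subT θ y) a))))
Val-⟵ (⇒ₗ r) f w a = f w (Val-⟶ r a)
Val-⟵ (⇒ᵣ r) f w a = Val-⟵ r (f w a)
Val-⟵ (∧ₗ r) (a , b) = Val-⟵ r a , b
Val-⟵ (∧ᵣ r) (a , b) = a , Val-⟵ r b
Val-⟵ (∨ₗ r) (inj₁ (inj₁ a)) = inj₁ (inj₁ (Val-⟵ r a))
Val-⟵ (∨ₗ r) (inj₁ (inj₂ b)) = inj₁ (inj₂ b)
Val-⟵ {θ = θ} (∨ₗ r) (inj₂ d) = inj₂ (Ne-conv d (≈-sym (⟶⇒≈ (⟶-subF θ (∨ₗ r)))))
Val-⟵ (∨ᵣ r) (inj₁ (inj₁ a)) = inj₁ (inj₁ a)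
Val-⟵ (∨ᵣ r) (inj₁ (inj₂ b)) = inj₁ (inj₂ (Val-⟵ r b))
Val-⟵ {θ = θ} (∨ᵣ r) (inj₂ d) = inj₂ (Ne-conv d (≈-sym (⟶⇒≈ (⟶-subF θ (∨ᵣ r)))))
Val-⟵ (∀c r) f w t = Val-⟵ r (f w t)
Val-⟵ (∃c r) (inj₁ (t , v)) = inj₁ (t , Val-⟵ r v)
Val-⟵ {θ = θ} (∃c r) (inj₂ d) = inj₂ (Ne-conv d (≈-sym (⟶⇒≈ (⟶-subF θ (∃c r)))))

Val-≈ : A ≈ B → Val θ Γ A → Val θ Γ B
Val-≈ ε              v = v
Val-≈ (fwd r ◅ rs) v = Val-≈ rs (Val-⟶ r v)
Val-≈ (bwd r ◅ rs) v = Val-≈ rs (Val-⟵ r v)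

-- Soundness and normalization

Env : (ℕ → Tm) → Ctx → Ctx → Set
Env θ Δ Γ = ∀ {n B} → Γ ∋ n ∶ B → Val θ Δ B

Env-cong : σ ≗ θ → Env σ Δ Γ → Env θ Δ Γ
Env-cong e γ {B = B} x = Val-cong B e (γ x)

Env-mono : (w : Δ ≤ Θ) → Env θ Δ Γ → Env (renT ⌊ w ⌋ ∘ θ) Θ Γ
Env-mono w γ {B = B} x = Val-mono B w (γ x)

Env-∷ : Val θ Δ A → Env θ Δ Γ → Env θ Δ (A ∷ Γ)
Env-∷ a γ here      = a
Env-∷ a γ (there x) = γ x

Env-↑F : ∀ t → Env θ Δ Γ → Env (t ∷ₛ θ) Δ (map ↑F Γ)
Env-↑F {Γ = Γ} t γ x with ∋-map⁻ Γ x
... | A , y , refl = Val-subF⁻ (var ∘ suc) A (γ y)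

Env-∷-wk : Env θ Δ Γ → Env θ (A ∷ Δ) Γ
Env-∷-wk {θ = θ} γ = Env-cong (renT-id∘ θ) (Env-mono ≤-∷ γ)

Env-∷-↑F : Env θ Δ Γ → Env (exts θ) (A ∷ map ↑F Δ) (map ↑F Γ)
Env-∷-↑F {θ = θ} γ = Env-cong (exts-as-∷ₛ θ) (Env-↑F (var 0) (Env-mono (≤-trans ≤-↑F ≤-∷) γ))

eval : ∀ {p} → Γ ⊢ p ∶ A → Env θ Δ Γ → Val θ Δ A
eval (ax x c) γ = Val-≈ c (γ x)
eval (⇒I d c) γ = Val-≈ (≈-sym c) λ w a → eval d (Env-∷ a (Env-mono w γ))
eval {θ = θ} (⇒E {A = A} {B = B} d d' c) γ =
  Val-cong B (renT-id∘ θ) (Val-≈ c (eval d γ) ≤-refl (Val-cong A (≗-sym (renT-id∘ θ)) (eval d' γ)))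
eval (∧I d d' c) γ = Val-≈ (≈-sym c) (eval d γ , eval d' γ)
eval (∧E₁ d c) γ = proj₁ (Val-≈ c (eval d γ))
eval (∧E₂ d c) γ = proj₂ (Val-≈ c (eval d γ))
eval (∨I₁ d c) γ = Val-≈ (≈-sym c) (inj₁ (inj₁ (eval d γ)))
eval (∨I₂ d c) γ = Val-≈ (≈-sym c) (inj₁ (inj₂ (eval d γ)))
eval (∨E {A = A} {B = B} {D = D} d c e f) γ with Val-≈ c (eval d γ)
... | inj₁ (inj₁ a) = eval e (Env-∷ a γ)
... | inj₁ (inj₂ b) = eval f (Env-∷ b γ)
... | inj₂ n = reflect D (case n ≈-refl
  (reify D (eval e (Env-∷ (reflect A (hyp here ≈-refl)) (Env-∷-wk γ))))
  (reify D (eval f (Env-∷ (reflect B (hyp here ≈-refl)) (Env-∷-wk γ)))))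
eval (⊤I c) γ = Val-≈ (≈-sym c) tt
eval (⊥E {A = A} d c) γ = reflect A (abort (Val-≈ c (eval d γ)) ≈-refl)
eval (∀I d c) γ = Val-≈ (≈-sym c) λ w t → eval d (Env-↑F t (Env-mono w γ))
eval {θ = θ} (∀E {A = A} t d c c') γ =
  Val-≈ (≈-sym c') (Val-subF⁻ (σ₀ t) A (Val-cong A (≗-sym (subT∘σ₀ θ t))
    (Val-cong A (∷ₛ-cong _ (renT-id∘ θ)) (Val-≈ c (eval d γ) ≤-refl (subT θ t)))))
eval {θ = θ} (∃I {A = A} t d c c') γ =
  Val-≈ (≈-sym c) (inj₁ (subT θ t , Val-cong A (subT∘σ₀ θ t) (Val-subF (σ₀ t) A (Val-≈ c' (eval d γ)))))
eval {θ = θ} (∃E {A = A} {B = B} d c e) γ with Val-≈ c (eval d γ)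
... | inj₁ (t , a) = Val-subF (var ∘ suc) B (eval e (Env-∷ a (Env-↑F t γ)))
... | inj₂ n = reflect B (unpack n ≈-refl
  (subst (Nf _) (subF-↑F θ B) (reify (↑F B) (eval e (Env-∷ (reflect A (hyp here ≈-refl)) (Env-∷-↑F γ))))))

Env-id : Env var Γ Γ
Env-id {B = B} x = reflect B (subst (Ne _) (sym (subF-id B)) (hyp x ≈-refl))

normalize : ∀ {p} → Γ ⊢ p ∶ A → Nf Γ A
normalize {A = A} d = subst (Nf _) (subF-id A) (reify A (eval d Env-id))

proposition21 : (Γ : Ctx) (A : Fm) → Provable Γ A → CutFreeProvable Γ A
proposition21 Γ A (_ , d) =
  eraseNf (normalize d) , eraseNf-⊢ (normalize d) , IsNf⇒Normal (eraseNf-IsNf (normalize d))
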